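{- For every finite $(3+1)$-free poset $P$ (i.e. $P$ has no induced subposet isomorphic to the disjoint union of a $3$-element chain and a $1$-element chain), there exists a part listing $L$ whose associated poset is $P$.
   Context: A bicoloured graph is a finite graph whose vertices are coloured `down' or `up', with every edge joining a down vertex to an up vertex. A part listing is a finite ordered list of parts, each placed on positive integer levels: a part is either a single vertex on some level $i\ge 1$ (written $v_i$), or a copy of a bicoloured graph $G$ placed on two adjacent levels $i$ and $i+1$, with its down vertices on level $i$ and its up vertices on level $i+1$ (written $b_{i,i+1}(G)$). The vertex set of the listing is the union of the vertices of its parts. The poset associated to a part listing $L$ has this vertex set, with $x<y$ if and only if (i) $x$ is at least two levels below $y$; or (ii) $x$ is exactly one level below $y$ and the part containing $x$ appears strictly before the part containing $y$ in $L$; or (iii) $x$ is exactly one level below $y$ and $x,y$ are joined by an edge of a bicoloured graph part. -}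

module Defs where

open import Data.Nat using (ℕ; suc; _+_; _≤_)
open import Data.Fin using (Fin) renaming (_<_ to _<ᶠ_)
open import Data.Bool using (Bool; T)
open import Data.Unit using (⊤)
open import Data.Empty using (⊥)
open import Data.Sum using (_⊎_; inj₁; inj₂)
open import Data.Product using (Σ; _×_; _,_; proj₁; proj₂; ∃)
open import Data.List using (List; length; lookup)
open import Data.List.Relation.Unary.All using (All)
open import Relation.Nullary using (¬_)
open import Relation.Binary.PropositionalEquality using (_≡_; _≢_)
open import Function.Bundles using (_⤖_; Bijection; _⇔_)

record FinPoset : Set₁ where
  field
    size  : ℕ
    lt    : Fin size → Fin size → Bool
    irrefl : ∀ x → ¬ T (lt x x)
    trans  : ∀ x y z → T (lt x y) → T (lt y z) → T (lt x z)

  _<P_ : Fin size → Fin size → Set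
  x <P y = T (lt x y)

  Incomparable : Fin size → Fin size → Set
  Incomparable x y = x ≢ y × ¬ (x <P y) × ¬ (y <P x)

Contains3+1 : FinPoset → Set
Contains3+1 P = ∃ λ a → ∃ λ b → ∃ λ c → ∃ λ d →
    a <P b × b <P c × Incomparable d a × Incomparable d b × Incomparable d c
  where open FinPoset P

Free3+1 : FinPoset → Set
Free3+1 P = ¬ Contains3+1 P

record BicGraph : Set where
  field
    down : ℕ
    up   : ℕ
    edge : Fin down → Fin up → Bool

-- Parts: a single vertex on level i, or b_{i,i+1}(G).
data Part : Set where
  vtx : (i : ℕ) → Part
  bic : (i : ℕ) → (G : BicGraph) → Part

partLevel : Part → ℕ
partLevel (vtx i)   = i
partLevel (bic i G) = i

ValidPart : Part → Set
ValidPart p = 1 ≤ partLevel p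

PartVertex : Part → Set
PartVertex (vtx i)   = ⊤
PartVertex (bic i G) = Fin (BicGraph.down G) ⊎ Fin (BicGraph.up G)

vertexLevel : (p : Part) → PartVertex p → ℕ
vertexLevel (vtx i)   _        = i
vertexLevel (bic i G) (inj₁ _) = i
vertexLevel (bic i G) (inj₂ _) = suc i

PartEdge : (p : Part) → PartVertex p → PartVertex p → Set
PartEdge (vtx i)   _        _        = ⊥
PartEdge (bic i G) (inj₁ a) (inj₂ b) = T (BicGraph.edge G a b)
PartEdge (bic i G) _        _        = ⊥

PartListing : Set
PartListing = List Part

ValidListing : PartListing → Set
ValidListing L = All ValidPart L

Vertex : PartListing → Set
Vertex L = Σ (Fin (length L)) λ k → PartVertex (lookup L k)

level : (L : PartListing) → Vertex L → ℕ
level L (k , v) = vertexLevel (lookup L k) v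

data ListingLt (L : PartListing) : Vertex L → Vertex L → Set where
  twoBelow : ∀ {x y} → 2 + level L x ≤ level L y → ListingLt L x y
  before   : ∀ {x y} → suc (level L x) ≡ level L y →
             proj₁ x <ᶠ proj₁ y → ListingLt L x y
  joined   : ∀ {k a b} → suc (level L (k , a)) ≡ level L (k , b) →
             PartEdge (lookup L k) a b → ListingLt L (k , a) (k , b)

AssociatedPosetIs : PartListing → FinPoset → Set
AssociatedPosetIs L P =
  Σ (Vertex L ⤖ Fin (FinPoset.size P)) λ f →
    ∀ x y → ListingLt L x y ⇔ FinPoset._<P_ P (Bijection.to f x) (Bijection.to f y)

-- Put every element x of P on level height x, the number of elements of a longest chain ending at x.
-- Then x < y forces height x < height y, and 3+1-freeness forces x < y whenever height y ≥ height x + 2,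
-- so only the relations between adjacent levels remain to be encoded by the order of the parts.
-- Call a → b an arc if b lies one level above a with a < b, or one level below a with b ≮ a: in either
-- case a cannot be listed in a later part than b. Choose v whose set Q of vertices with a walk to v is
-- smallest; Q is closed under arcs backwards and strongly connected. Every closed walk spans at most two
-- levels, because a walk climbing twice and then descending (x ↗ y ↗ z ↘ w) either gives a 3+1 or can
-- be shortened by the arc x ↗ w. So Q is one bicoloured part, listed in front of a listing of the rest.

module Submission where

open import Defs
open import Data.Bool using (Bool; true; false; T; not; _∧_; _∨_; if_then_else_)
open import Data.Bool.Properties using (T?; T-≡; T-∧; T-∨)
open import Data.Empty using (⊥; ⊥-elim)
open import Data.Fin using (Fin; zero; suc)
open import Data.Fin.Properties using (any?; _≟_)
import Data.Fin.Subset as Subset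
import Data.Fin.Subset.Properties as Subset
open import Data.List using (List; []; _∷_; lookup; filter; allFin)
import Data.List as List
open import Data.List.Membership.Propositional using (_∈_)
open import Data.List.Membership.Propositional.Properties using (∈-filter⁺; ∈-filter⁻; ∈-allFin; ∈-lookup)
open import Data.List.Relation.Unary.Any using (index)
open import Data.List.Relation.Unary.Any.Properties using (lookup-index)
open import Data.List.Relation.Unary.Unique.Propositional using (Unique)
open import Data.List.Relation.Unary.Unique.Propositional.Properties using (allFin⁺; filter⁺; Unique[x∷xs]⇒x∉xs)
open import Data.List.Relation.Unary.AllPairs using ([]; _∷_)
open import Data.List.Relation.Unary.All using ([]; _∷_)
open import Data.Nat using (ℕ; zero; suc; _+_; _∸_; _≤_; _<_; _⊔_; _⊓_; z≤n; s≤s; _≤?_; _<?_; _≡ᵇ_)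
open import Data.Nat.Properties hiding (_≟_)
open import Data.Nat.Properties using () renaming (_≟_ to _≟ℕ_)
open import Data.Product using (Σ; Σ-syntax; _×_; _,_; proj₁; proj₂)
open import Data.Sum using (_⊎_; inj₁; inj₂)
open import Data.Unit using (tt)
open import Data.Vec using (tabulate)
open import Data.Vec.Properties using (lookup∘tabulate; lookup⇒[]=; []=⇒lookup)
open import Relation.Binary.Construct.Closure.ReflexiveTransitive using (Star; ε; _◅_; _◅◅_)
open import Function using (_∘_; Equivalence)
open import Function.Bundles using (_⤖_; mk⇔)
open import Relation.Binary.PropositionalEquality using (_≡_; _≢_; refl; sym; trans; cong; cong₂; subst; subst₂)
open import Relation.Nullary using (¬_; Dec; yes; no; contradiction)
open import Relation.Nullary.Decidable using (map′; ⌊_⌋; toWitness; fromWitness; decidable-stable; _×-dec_; _⊎-dec_; ¬?)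

private
  variable
    n : ℕ

-- Subsets of Fin n

Sub : ℕ → Set
Sub n = Fin n → Bool

_⊆_ : Sub n → Sub n → Set
S ⊆ S′ = ∀ x → T (S x) → T (S′ x)

_─_ : Sub n → Sub n → Sub n
(S ─ S′) x = S x ∧ not (S′ x)

∈─⁻ : ∀ (S S′ : Sub n) {x} → T ((S ─ S′) x) → T (S x) × ¬ T (S′ x)
∈─⁻ S S′ {x} x∈ with S x | S′ x
... | true | false = tt , λ ()

∈─⁺ : ∀ (S S′ : Sub n) {x} → T (S x) → ¬ T (S′ x) → T ((S ─ S′) x)
∈─⁺ S S′ {x} x∈S x∉S′ with S x | S′ x
... | true | false = tt
... | true | true  = x∉S′ tt

count : Sub n → ℕ
count S = Subset.∣ tabulate S ∣

∈-tabulate⁺ : ∀ (S : Sub n) {x} → T (S x) → x Subset.∈ tabulate S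
∈-tabulate⁺ S {x} Sx = lookup⇒[]= x (tabulate S) (trans (lookup∘tabulate S x) (Equivalence.to T-≡ Sx))

∈-tabulate⁻ : ∀ (S : Sub n) {x} → x Subset.∈ tabulate S → T (S x)
∈-tabulate⁻ S {x} x∈S = Equivalence.from T-≡ (trans (sym (lookup∘tabulate S x)) ([]=⇒lookup x∈S))

count≤n : (S : Sub n) → count S ≤ n
count≤n S = Subset.∣p∣≤n (tabulate S)

count-< : ∀ {S S′ : Sub n} → S ⊆ S′ → ∀ x → T (S′ x) → ¬ T (S x) → count S < count S′
count-< {S = S} {S′} S⊆S′ x S′x ¬Sx = Subset.p⊂q⇒∣p∣<∣q∣
  ( (λ y∈S → ∈-tabulate⁺ S′ (S⊆S′ _ (∈-tabulate⁻ S y∈S)))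
  , x , ∈-tabulate⁺ S′ S′x , ¬Sx ∘ ∈-tabulate⁻ S )

count-<n : ∀ (S : Sub n) x → ¬ T (S x) → count S < n
count-<n S x ¬Sx = <-≤-trans (count-< (λ _ _ → tt) x tt ¬Sx) (count≤n (λ _ → true))

count-pos : ∀ (S : Sub n) x → T (S x) → 0 < count S
count-pos S x Sx = ≤-<-trans z≤n (count-< {S = λ _ → false} (λ _ ()) x Sx (λ ()))

count-⊆-≤⇒⊇ : ∀ {S S′ : Sub n} → S ⊆ S′ → count S′ ≤ count S → S′ ⊆ S
count-⊆-≤⇒⊇ {S = S} S⊆S′ count≤ a S′a with T? (S a)
... | yes Sa = Sa
... | no ¬Sa = contradiction count≤ (<⇒≱ (count-< S⊆S′ a S′a ¬Sa))

members : Sub n → List (Fin n)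
members S = filter (T? ∘ S) (allFin _)

lookup-injective : ∀ {A : Set} {xs : List A} → Unique xs → ∀ {i j} → lookup xs i ≡ lookup xs j → i ≡ j
lookup-injective {xs = _ ∷ _} _ {zero}  {zero}  _  = refl
lookup-injective {xs = _ ∷ _} u {zero}  {suc j} eq =
  contradiction (subst (_∈ _) (sym eq) (∈-lookup j)) (Unique[x∷xs]⇒x∉xs u)
lookup-injective {xs = _ ∷ _} u {suc i} {zero}  eq =
  contradiction (subst (_∈ _) eq (∈-lookup i)) (Unique[x∷xs]⇒x∉xs u)
lookup-injective {xs = _ ∷ _} (_ ∷ u) {suc i} {suc j} eq = cong suc (lookup-injective u eq)

lookup-members : ∀ (S : Sub n) i → T (S (lookup (members S) i))
lookup-members S i = proj₂ (∈-filter⁻ (T? ∘ S) {xs = allFin _} (∈-lookup i))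

lookup-members-injective : ∀ (S : Sub n) {i j} → lookup (members S) i ≡ lookup (members S) j → i ≡ j
lookup-members-injective S = lookup-injective (filter⁺ (T? ∘ S) (allFin⁺ _))

lookup-members-surjective : ∀ (S : Sub n) x → T (S x) →
                            Σ[ i ∈ Fin (List.length (members S)) ] lookup (members S) i ≡ x
lookup-members-surjective S x Sx = index x∈ , sym (lookup-index x∈)
  where x∈ = ∈-filter⁺ (T? ∘ S) (∈-allFin x) Sx

argmin : ∀ (F : Fin n → ℕ) (S : Sub n) x → T (S x) →
         Σ[ v ∈ Fin n ] T (S v) × (∀ u → T (S u) → F v ≤ F u)
argmin F S x Sx = search (suc (F x)) x Sx ≤-refl
  where
  search : ∀ k x → T (S x) → F x < k → Σ[ v ∈ Fin _ ] T (S v) × (∀ u → T (S u) → F v ≤ F u)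
  search (suc k) x Sx Fx≤k with any? (λ u → T? (S u) ×-dec F u <? F x)
  ... | yes (u , Su , Fu<Fx) = search k u Su (≤-trans Fu<Fx (≤-pred Fx≤k))
  ... | no ∄u = x , Sx , λ u Su → ≮⇒≥ (λ Fu<Fx → ∄u (u , Su , Fu<Fx))

-- Reachability

iterate : ∀ {A : Set} → (A → A) → ℕ → A → A
iterate f zero    x = x
iterate f (suc k) x = f (iterate f k x)

module Saturation (f : Sub n → Sub n)
                  (f-mono : ∀ {S S′} → S ⊆ S′ → f S ⊆ f S′)
                  (f-inflationary : ∀ S → S ⊆ f S) (S : Sub n) where

  Saturated : ℕ → Set
  Saturated k = f (iterate f k S) ⊆ iterate f k S

  saturated-suc : ∀ {k} → Saturated k → Saturated (suc k)
  saturated-suc sat = f-mono sat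

  saturated-+ : ∀ {k} j → Saturated k → Saturated (j + k)
  saturated-+ zero    sat = sat
  saturated-+ {k} (suc j) sat = saturated-suc {j + k} (saturated-+ j sat)

  -- An unsaturated step adds an element, so the chain cannot grow for more than n steps.
  saturated-or-large : ∀ m → (Σ[ k ∈ ℕ ] k < m × Saturated k) ⊎ m ≤ count (iterate f m S)
  saturated-or-large zero = inj₂ z≤n
  saturated-or-large (suc m) with saturated-or-large m
  ... | inj₁ (k , k<m , sat) = inj₁ (k , m<n⇒m<1+n k<m , sat)
  ... | inj₂ m≤count with any? (λ a → T? (iterate f (suc m) S a) ×-dec ¬? (T? (iterate f m S a)))
  ...   | yes (a , new , ¬old) = inj₂ (<-≤-trans (s≤s m≤count) (count-< (f-inflationary _) a new ¬old))
  ...   | no ∄a = inj₁ (m , ≤-refl , λ a fa → decidable-stable (T? _) (λ ¬old → ∄a (a , fa , ¬old)))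

  saturated-at-n : Saturated n
  saturated-at-n with saturated-or-large (suc n)
  ... | inj₁ (k , k≤n , sat) = subst Saturated (m∸n+n≡m (≤-pred k≤n)) (saturated-+ (n ∸ k) sat)
  ... | inj₂ large = contradiction (≤-trans large (count≤n _)) (<-irrefl refl)

module Closure {E : Fin n → Fin n → Set} (E? : ∀ a b → Dec (E a b)) where

  grow : Sub n → Sub n
  grow S a = S a ∨ ⌊ any? (λ b → E? a b ×-dec T? (S b)) ⌋

  grow-inflationary : ∀ S → S ⊆ grow S
  grow-inflationary S a Sa = Equivalence.from T-∨ (inj₁ Sa)

  grow-step : ∀ {S a b} → E a b → T (S b) → T (grow S a)
  grow-step {S} {a} {b} e Sb =
    Equivalence.from T-∨ (inj₂ (fromWitness {a? = any? (λ b → E? a b ×-dec T? (S b))} (b , e , Sb)))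

  grow-cases : ∀ {S} a → T (grow S a) → T (S a) ⊎ Σ[ b ∈ Fin n ] E a b × T (S b)
  grow-cases {S} a g with Equivalence.to T-∨ g
  ... | inj₁ Sa = inj₁ Sa
  ... | inj₂ w  = inj₂ (toWitness {a? = any? (λ b → E? a b ×-dec T? (S b))} w)

  grow-mono : ∀ {S S′} → S ⊆ S′ → grow S ⊆ grow S′
  grow-mono S⊆S′ a g with grow-cases a g
  ... | inj₁ Sa            = grow-inflationary _ a (S⊆S′ a Sa)
  ... | inj₂ (b , e , Sb) = grow-step e (S⊆S′ b Sb)

  Closed : Sub n → Set
  Closed C = ∀ {a b} → E a b → T (C b) → T (C a)

  grow-closed : ∀ {C} → Closed C → grow C ⊆ C
  grow-closed closed a g with grow-cases a g
  ... | inj₁ Ca            = Ca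
  ... | inj₂ (b , e , Cb) = closed e Cb

  ⁅_⁆ : Fin n → Sub n
  ⁅ v ⁆ a = ⌊ a ≟ v ⌋

  reach : Fin n → Sub n
  reach v = iterate grow n ⁅ v ⁆

  reach-closed : ∀ v → Closed (reach v)
  reach-closed v e rb = saturated-at-n _ (grow-step e rb)
    where open Saturation grow grow-mono grow-inflationary ⁅ v ⁆

  ⁅v⁆⊆iterate : ∀ v k → ⁅ v ⁆ ⊆ iterate grow k ⁅ v ⁆
  ⁅v⁆⊆iterate v zero    a = λ x → x
  ⁅v⁆⊆iterate v (suc k) a = grow-inflationary _ a ∘ ⁅v⁆⊆iterate v k a

  reach-refl : ∀ v → T (reach v v)
  reach-refl v = ⁅v⁆⊆iterate v n v (fromWitness refl)

  iterate-least : ∀ {C} v → Closed C → T (C v) → ∀ k → iterate grow k ⁅ v ⁆ ⊆ C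
  iterate-least v closed Cv zero    a a≡v with toWitness a≡v
  ... | refl = Cv
  iterate-least v closed Cv (suc k) a g = grow-closed closed a (grow-mono (iterate-least v closed Cv k) a g)

  reach-least : ∀ {C} v → Closed C → T (C v) → reach v ⊆ C
  reach-least v closed Cv = iterate-least v closed Cv n

  iterate⇒Star : ∀ v k a → T (iterate grow k ⁅ v ⁆ a) → Star E a v
  iterate⇒Star v zero    a a≡v with toWitness a≡v
  ... | refl = ε
  iterate⇒Star v (suc k) a g with grow-cases a g
  ... | inj₁ r             = iterate⇒Star v k a r
  ... | inj₂ (b , e , rb) = e ◅ iterate⇒Star v k b rb

  reach⇒Star : ∀ {v a} → T (reach v a) → Star E a v
  reach⇒Star = iterate⇒Star _ n _

  minimal-reach⇒Star : ∀ {v q} → T (reach v q) → count (reach v) ≤ count (reach q) → Star E v q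
  minimal-reach⇒Star {v} {q} rq minimal =
    reach⇒Star (count-⊆-≤⇒⊇ (reach-least q (reach-closed v) rq) minimal v (reach-refl v))

-- Heights

maxF : (Fin n → ℕ) → ℕ
maxF {zero}  f = 0
maxF {suc n} f = f zero ⊔ maxF (f ∘ suc)

maxF-upper : ∀ (f : Fin n → ℕ) x → f x ≤ maxF f
maxF-upper f zero    = m≤m⊔n _ _
maxF-upper f (suc x) = ≤-trans (maxF-upper (f ∘ suc) x) (m≤n⊔m _ _)

maxF-attained : ∀ (f : Fin n → ℕ) → 0 < maxF f → Σ[ x ∈ Fin n ] maxF f ≡ f x
maxF-attained {suc n} f pos with ⊔-sel (f zero) (maxF (f ∘ suc))
... | inj₁ eq = zero , eq
... | inj₂ eq with maxF-attained (f ∘ suc) (subst (0 <_) eq pos)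
...   | x , eq′ = suc x , trans eq eq′

maxF-cong : ∀ {f g : Fin n → ℕ} → (∀ x → f x ≡ g x) → maxF f ≡ maxF g
maxF-cong {zero}  f≗g = refl
maxF-cong {suc n} f≗g = cong₂ _⊔_ (f≗g zero) (maxF-cong (f≗g ∘ suc))

if-true : ∀ {b} {m : ℕ} → T b → (if b then m else 0) ≡ m
if-true {true} _ = refl

if-pos : ∀ b {m} → 0 < (if b then m else 0) → T b
if-pos true _ = tt

if-cong : ∀ b {m m′ : ℕ} → (T b → m ≡ m′) → (if b then m else 0) ≡ (if b then m′ else 0)
if-cong true  eq = eq tt
if-cong false eq = refl

module LongestChain (P : FinPoset) where
  open FinPoset P renaming (trans to <P-trans)

  strictDownset : Fin size → Sub size
  strictDownset y z = lt z y

  approximation : ℕ → Fin size → ℕ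
  approximation zero    y = 1
  approximation (suc k) y = suc (maxF λ z → if lt z y then approximation k z else 0)

  approximation-stable : ∀ k y → count (strictDownset y) < k → approximation k y ≡ approximation (suc k) y
  approximation-stable (suc k) y count<k = cong suc (maxF-cong λ z → if-cong (lt z y) λ z<y →
    approximation-stable k z (≤-trans (count-< (λ w w<z → <P-trans w z y w<z z<y) z z<y (irrefl z))
                                      (≤-pred count<k)))

  height : Fin size → ℕ
  height = approximation size

  height-unfold : ∀ y → height y ≡ suc (maxF λ z → if lt z y then height z else 0)
  height-unfold y = approximation-stable size y (count-<n (strictDownset y) y (irrefl y))

  height-pos : ∀ y → 1 ≤ height y
  height-pos y rewrite height-unfold y = s≤s z≤n

  <⇒height< : ∀ {z y} → z <P y → height z < height y
  <⇒height< {z} {y} z<y rewrite height-unfold y =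
    s≤s (subst (_≤ _) (if-true z<y) (maxF-upper (λ w → if lt w y then height w else 0) z))

  height-covered : ∀ y → 2 ≤ height y → Σ[ z ∈ Fin size ] z <P y × suc (height z) ≡ height y
  height-covered y 2≤hy with maxF-attained (λ w → if lt w y then height w else 0) max-pos
    where max-pos = ≤-pred (subst (2 ≤_) (height-unfold y) 2≤hy)
  ... | z , max≡ = z , z<y , sym (trans (height-unfold y) (cong suc (trans max≡ (if-true z<y))))
    where
    z<y : z <P y
    z<y = if-pos (lt z y) (subst (0 <_) max≡ (≤-pred (subst (2 ≤_) (height-unfold y) 2≤hy)))

  height≢⇒≢ : ∀ {x y} → height x ≢ height y → x ≢ y
  height≢⇒≢ h≢ refl = h≢ refl

  height≤⇒≯ : ∀ {x y} → height x ≤ height y → ¬ y <P x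
  height≤⇒≯ hx≤hy y<x = <⇒≱ (<⇒height< y<x) hx≤hy

module ThreePlusOneFree (P : FinPoset) (free : Free3+1 P) where
  open FinPoset P renaming (trans to <P-trans)
  open LongestChain P

  no-3+1-across-level : ∀ {a b c d} → a <P b → b <P c → height d ≡ height b → ¬ a <P d → ¬ d <P c → ⊥
  no-3+1-across-level {a} {b} {c} {d} a<b b<c hd≡hb a≮d d≮c =
    free (a , b , c , d , a<b , b<c , d∥a , d∥b , d∥c)
    where
    ha<hd = subst (height a <_) (sym hd≡hb) (<⇒height< a<b)
    hd<hc = subst (_< height c) (sym hd≡hb) (<⇒height< b<c)
    d∥a : Incomparable d a
    d∥a = height≢⇒≢ (>⇒≢ ha<hd) , height≤⇒≯ (<⇒≤ ha<hd) , a≮d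
    d∥b : Incomparable d b
    d∥b = (λ { refl → d≮c b<c }) , height≤⇒≯ (≤-reflexive (sym hd≡hb)) , height≤⇒≯ (≤-reflexive hd≡hb)
    d∥c : Incomparable d c
    d∥c = height≢⇒≢ (<⇒≢ hd<hc) , d≮c , height≤⇒≯ (<⇒≤ hd<hc)

  height-gap⇒< : ∀ {x y} → 2 + height x ≤ height y → x <P y
  height-gap⇒< {x} {y} gap with T? (lt x y)
  ... | yes x<y = x<y
  ... | no  x≮y with height-covered y (≤-trans (s≤s (s≤s z≤n)) gap)
  ...   | w , w<y , hw+1≡hy with ≤-pred (subst (2 + height x ≤_) (sym hw+1≡hy) gap)
  ...     | hx<hw with height-covered w (≤-trans (s≤s (height-pos x)) hx<hw)
  ...       | z , z<w , hz+1≡hw = ⊥-elim (free (z , w , y , x , z<w , w<y , x∥z , x∥w , x∥y))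
    where
    hx≤hz : height x ≤ height z
    hx≤hz = ≤-pred (subst (height x <_) (sym hz+1≡hw) hx<hw)
    x≮w : ¬ x <P w
    x≮w x<w = x≮y (<P-trans x w y x<w w<y)
    x∥z : Incomparable x z
    x∥z = (λ x≡z → x≮w (subst (_<P w) (sym x≡z) z<w)) , (λ x<z → x≮w (<P-trans x z w x<z z<w))
        , height≤⇒≯ hx≤hz
    x∥w : Incomparable x w
    x∥w = height≢⇒≢ (<⇒≢ hx<hw) , x≮w , height≤⇒≯ (<⇒≤ hx<hw)
    hx<hy : height x < height y
    hx<hy = ≤-trans (n≤1+n _) gap
    x∥y : Incomparable x y
    x∥y = height≢⇒≢ (<⇒≢ hx<hy) , x≮y , height≤⇒≯ (<⇒≤ hx<hy)

-- Walks along arcs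

⊔≡ʳ : ∀ {m n} → m < m ⊔ n → m ⊔ n ≡ n
⊔≡ʳ {m} {n} m<m⊔n with ⊔-sel m n
... | inj₁ eq = contradiction (subst (m <_) eq m<m⊔n) (<-irrefl refl)
... | inj₂ eq = eq

module Blocks (P : FinPoset) (free : Free3+1 P) (X : Sub (FinPoset.size P)) where
  open FinPoset P hiding (trans)
  open LongestChain P
  open ThreePlusOneFree P free

  -- Arc a b: within X, a may not be listed in a later part than b.
  data Arc (a b : Fin size) : Set where
    up   : T (X a) → T (X b) → height b ≡ suc (height a) → a <P b → Arc a b
    down : T (X a) → T (X b) → height a ≡ suc (height b) → ¬ b <P a → Arc a b

  Walk : Fin size → Fin size → Set
  Walk = Star Arc

  length : ∀ {a b} → Walk a b → ℕ
  length ε       = 0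
  length (_ ◅ w) = suc (length w)

  top bot : ∀ {a b} → Walk a b → ℕ
  top {a} ε       = height a
  top {a} (_ ◅ w) = height a ⊔ top w
  bot {a} ε       = height a
  bot {a} (_ ◅ w) = height a ⊓ bot w

  length-◅◅ : ∀ {a b c} (α : Walk a b) (β : Walk b c) → length (α ◅◅ β) ≡ length α + length β
  length-◅◅ ε       β = refl
  length-◅◅ (_ ◅ α) β = cong suc (length-◅◅ α β)

  top-start : ∀ {a b} (w : Walk a b) → height a ≤ top w
  top-start ε       = ≤-refl
  top-start (_ ◅ w) = m≤m⊔n _ _

  bot-start : ∀ {a b} (w : Walk a b) → bot w ≤ height a
  bot-start ε       = ≤-refl
  bot-start (_ ◅ w) = m⊓n≤m _ _

  top-◅◅ : ∀ {a b c} (α : Walk a b) (β : Walk b c) → top (α ◅◅ β) ≡ top α ⊔ top β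
  top-◅◅ ε       β = sym (m≤n⇒m⊔n≡n (top-start β))
  top-◅◅ {a} (_ ◅ α) β = trans (cong (height a ⊔_) (top-◅◅ α β)) (sym (⊔-assoc (height a) (top α) (top β)))

  bot-◅◅ : ∀ {a b c} (α : Walk a b) (β : Walk b c) → bot (α ◅◅ β) ≡ bot α ⊓ bot β
  bot-◅◅ ε       β = sym (m≥n⇒m⊓n≡n (bot-start β))
  bot-◅◅ {a} (_ ◅ α) β = trans (cong (height a ⊓_) (bot-◅◅ α β)) (sym (⊓-assoc (height a) (bot α) (bot β)))

  top-end : ∀ {a b} (w : Walk a b) → height b ≤ top w
  top-end ε       = ≤-refl
  top-end (_ ◅ w) = ≤-trans (top-end w) (m≤n⊔m _ _)

  top-◅◅ˡ : ∀ {a b c} (α : Walk a b) (β : Walk b c) → top α ≤ top (α ◅◅ β)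
  top-◅◅ˡ α β = ≤-trans (m≤m⊔n _ _) (≤-reflexive (sym (top-◅◅ α β)))

  top-◅◅ʳ : ∀ {a b c} (α : Walk a b) (β : Walk b c) → top β ≤ top (α ◅◅ β)
  top-◅◅ʳ α β = ≤-trans (m≤n⊔m _ _) (≤-reflexive (sym (top-◅◅ α β)))

  bot-◅◅ˡ : ∀ {a b c} (α : Walk a b) (β : Walk b c) → bot (α ◅◅ β) ≤ bot α
  bot-◅◅ˡ α β = ≤-trans (≤-reflexive (bot-◅◅ α β)) (m⊓n≤m _ _)

  bot-◅◅ʳ : ∀ {a b c} (α : Walk a b) (β : Walk b c) → bot (α ◅◅ β) ≤ bot β
  bot-◅◅ʳ α β = ≤-trans (≤-reflexive (bot-◅◅ α β)) (m⊓n≤n _ _)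

  record Peak (s e : Fin size) (bound : ℕ) : Set where
    field
      x y z w : Fin size
      prefix : Walk s x
      suffix : Walk w e
      x∈X    : T (X x)
      w∈X    : T (X w)
      x<y    : x <P y
      y<z    : y <P z
      w≮z    : ¬ w <P z
      hy≡1+hx : height y ≡ suc (height x)
      hz≡1+hy : height z ≡ suc (height y)
      hz≡1+hw : height z ≡ suc (height w)
      short  : 3 + (length prefix + length suffix) ≤ bound

  Peak-◅ : ∀ {s t e bound} → Arc s t → Peak t e bound → Peak s e (suc bound)
  Peak-◅ arc peak = record
    { x = x ; y = y ; z = z ; w = w ; prefix = arc ◅ prefix ; suffix = suffix ; x∈X = x∈X ; w∈X = w∈X
    ; x<y = x<y ; y<z = y<z ; w≮z = w≮z ; hy≡1+hx = hy≡1+hx ; hz≡1+hy = hz≡1+hy ; hz≡1+hw = hz≡1+hw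
    ; short = s≤s short }
    where open Peak peak

  top-◅ : ∀ {a b c} (arc : Arc a b) (ν : Walk b c) → top ν ≤ top (arc ◅ ν)
  top-◅ _ _ = m≤n⊔m _ _

  bot-◅ : ∀ {a b c} (arc : Arc a b) (ν : Walk b c) → bot (arc ◅ ν) ≤ bot ν
  bot-◅ _ _ = m⊓n≤n _ _

  -- Follow the walk up to an up arc after which it stays within one level above the arc's head:
  -- the walk must climb once more and then descend, since it ends below its top.
  mutual
    findPeak : ∀ {s e} (ν : Walk s e) → 2 + height s ≤ top ν → suc (height e) ≤ top ν →
               Peak s e (length ν)
    findPeak ε high _ = contradiction (≤-trans (n≤1+n _) high) 1+n≰n
    findPeak {s} {e} (arc ◅ ν) high low =
      findPeakAfter arc ν (subst (2 + height s ≤_) top≡ high) (subst (suc (height e) ≤_) top≡ low)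
      where top≡ = ⊔≡ʳ (≤-trans (n≤1+n _) high)

    findPeakAfter : ∀ {s t e} → Arc s t → (ν : Walk t e) → 2 + height s ≤ top ν → suc (height e) ≤ top ν →
                    Peak s e (suc (length ν))
    findPeakAfter arc@(down _ _ hs≡1+ht _) ν high low =
      Peak-◅ arc (findPeak ν (≤-trans (+-monoʳ-≤ 2 (≤-trans (n≤1+n _) (≤-reflexive (sym hs≡1+ht)))) high) low)
    findPeakAfter {s} {t} arc@(up s∈X _ ht≡1+hs s<t) ν high low with 2 + height t ≤? top ν
    ... | yes higher = Peak-◅ arc (findPeak ν higher low)
    ... | no  ¬higher = turn ν high low (≤-pred (≰⇒> ¬higher))
      where
      turn : ∀ {e} (ν : Walk t e) → 2 + height s ≤ top ν → suc (height e) ≤ top ν → top ν ≤ suc (height t) →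
             Peak s e (suc (length ν))
      turn ε high _ _ = contradiction (≤-trans high (≤-reflexive ht≡1+hs)) 1+n≰n
      turn (up _ _ hu≡1+ht _ ◅ ε) _ low flat =
        contradiction (≤-trans low (≤-trans flat (≤-reflexive (sym hu≡1+ht)))) 1+n≰n
      turn (arc′@(up _ _ hu≡1+ht _) ◅ arc″@(up _ _ hv≡1+hu _) ◅ ν) _ _ flat = contradiction
        (≤-trans (≤-reflexive (trans (cong suc (sym hu≡1+ht)) (sym hv≡1+hu)))
                 (≤-trans (top-start ν) (≤-trans (top-◅ arc″ ν) (≤-trans (top-◅ arc′ (arc″ ◅ ν)) flat))))
        1+n≰n
      turn (up _ _ hu≡1+ht t<u ◅ down _ v∈X hu≡1+hv v≮u ◅ ν) _ _ _ = record
        { x = s ; y = t ; z = _ ; w = _ ; prefix = ε ; suffix = ν ; x∈X = s∈X ; w∈X = v∈X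
        ; x<y = s<t ; y<z = t<u ; w≮z = v≮u
        ; hy≡1+hx = ht≡1+hs ; hz≡1+hy = hu≡1+ht ; hz≡1+hw = hu≡1+hv ; short = ≤-refl }
      turn {e} (arc′@(down _ _ ht≡1+hu _) ◅ ν) high low _ =
        Peak-◅ arc (Peak-◅ arc′ (findPeak ν (subst (2 + height _ ≤_) top≡ high′)
                                            (subst (suc (height e) ≤_) top≡ low)))
        where
        high′ = subst (λ h → 2 + h ≤ _) (suc-injective (trans (sym ht≡1+hs) ht≡1+hu)) high
        top≡ = ⊔≡ʳ (≤-trans (≤-reflexive (cong suc ht≡1+hs)) high)

  module _ {x y z} (x<y : x <P y) (y<z : y <P z) (hy≡1+hx : height y ≡ suc (height x)) where

    -- Such a walk alternates between the heights of y and x; its first descent that is not followed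
    -- by a climb to an element below z is a 3+1.
    no-flat-walk : ∀ {a} (γ : Walk a x) → height a ≡ height y → ¬ a <P z →
                   height x ≤ bot γ → top γ ≤ height y → ⊥
    no-flat-walk ε ha≡hy _ _ _ = 1+n≢n (sym (trans ha≡hy hy≡1+hx))
    no-flat-walk (up _ _ hb≡1+ha _ ◅ γ) ha≡hy _ _ low = 1+n≰n
      (≤-trans (≤-reflexive (trans (cong suc (sym ha≡hy)) (sym hb≡1+ha)))
               (≤-trans (top-start γ) (≤-trans (m≤n⊔m _ _) low)))
    no-flat-walk (down _ _ _ x≮a ◅ ε) ha≡hy a≮z _ _ = no-3+1-across-level x<y y<z ha≡hy x≮a a≮z
    no-flat-walk (arc@(down _ _ ha≡1+hb _) ◅ arc′@(down _ _ hb≡1+ha′ _) ◅ γ) ha≡hy _ high _ = 1+n≰n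
      (≤-trans (s≤s (≤-trans high (≤-trans (bot-◅ arc (arc′ ◅ γ)) (≤-trans (bot-◅ arc′ γ) (bot-start γ)))))
               (≤-reflexive (trans (sym hb≡1+ha′) hb≡hx)))
      where hb≡hx = suc-injective (trans (sym ha≡1+hb) (trans ha≡hy hy≡1+hx))
    no-flat-walk (arc@(down _ _ ha≡1+hb b≮a) ◅ _◅_ {j = a′} arc′@(up _ _ ha′≡1+hb b<a′) γ)
                 ha≡hy a≮z high low with T? (lt a′ z)
    ... | yes a′<z = no-3+1-across-level b<a′ a′<z (trans ha≡hy (sym ha′≡hy)) b≮a a≮z
      where ha′≡hy = trans ha′≡1+hb (trans (sym ha≡1+hb) ha≡hy)
    ... | no  a′≮z = no-flat-walk γ (trans ha′≡1+hb (trans (sym ha≡1+hb) ha≡hy)) a′≮z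
                       (≤-trans high (≤-trans (bot-◅ arc (arc′ ◅ γ)) (bot-◅ arc′ γ)))
                       (≤-trans (≤-trans (top-◅ arc′ γ) (top-◅ arc (arc′ ◅ γ))) low)

  split-at-bot : ∀ {s e} (ν : Walk s e) → Σ[ m ∈ Fin size ] Σ[ α ∈ Walk s m ] Σ[ β ∈ Walk m e ]
                 α ◅◅ β ≡ ν × height m ≡ bot ν
  split-at-bot {s} ε = s , ε , ε , refl , refl
  split-at-bot {s} (arc ◅ ν) with height s ≤? bot ν | split-at-bot ν
  ... | yes hs≤ | _ = s , ε , arc ◅ ν , refl , sym (m≤n⇒m⊓n≡m hs≤)
  ... | no  hs≰ | m , α , β , α◅◅β≡ν , hm≡ =
    m , arc ◅ α , β , cong (arc ◅_) α◅◅β≡ν , trans hm≡ (sym (m≥n⇒m⊓n≡n (<⇒≤ (≰⇒> hs≰))))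

  rotate-to-bot : ∀ {s} (ν : Walk s s) → Σ[ m ∈ Fin size ] Σ[ ν′ ∈ Walk m m ]
                  length ν′ ≡ length ν × top ν′ ≡ top ν × height m ≡ bot ν
  rotate-to-bot ν with split-at-bot ν
  ... | m , α , β , refl , hm≡ = m , β ◅◅ α , length≡ , top≡ , hm≡
    where
    length≡ = trans (length-◅◅ β α) (trans (+-comm (length β) (length α)) (sym (length-◅◅ α β)))
    top≡ = trans (top-◅◅ β α) (trans (⊔-comm (top β) (top α)) (sym (top-◅◅ α β)))

  shortcut-bounds : ∀ {m x w} (α : Walk m x) (arc : Arc x w) (β : Walk w m) → height w ≡ suc (height x) →
                    top (α ◅◅ arc ◅ β) ≤ suc (bot (α ◅◅ arc ◅ β)) →
                    height x ≤ bot (β ◅◅ α) × top (β ◅◅ α) ≤ suc (height x)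
  shortcut-bounds {x = x} {w} α arc β hw≡1+hx flat = hx≤bot′ , top′≤1+hx
    where
    open ≤-Reasoning
    ν = α ◅◅ arc ◅ β
    bot≤hx : bot ν ≤ height x
    bot≤hx = ≤-trans (bot-◅◅ʳ α (arc ◅ β)) (m⊓n≤m _ _)
    hx≤bot : height x ≤ bot ν
    hx≤bot = ≤-pred (begin
      suc (height x)  ≡⟨ sym hw≡1+hx ⟩
      height w        ≤⟨ top-start β ⟩
      top β           ≤⟨ top-◅ arc β ⟩
      top (arc ◅ β)   ≤⟨ top-◅◅ʳ α (arc ◅ β) ⟩
      top ν           ≤⟨ flat ⟩
      suc (bot ν)     ∎)
    hx≤bot′ : height x ≤ bot (β ◅◅ α)
    hx≤bot′ = begin
      height x        ≤⟨ hx≤bot ⟩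
      bot ν           ≤⟨ ⊓-glb (≤-trans (bot-◅◅ʳ α (arc ◅ β)) (bot-◅ arc β)) (bot-◅◅ˡ α (arc ◅ β)) ⟩
      bot β ⊓ bot α   ≡⟨ sym (bot-◅◅ β α) ⟩
      bot (β ◅◅ α)    ∎
    top′≤1+hx : top (β ◅◅ α) ≤ suc (height x)
    top′≤1+hx = begin
      top (β ◅◅ α)    ≡⟨ top-◅◅ β α ⟩
      top β ⊔ top α   ≤⟨ ⊔-lub (≤-trans (top-◅ arc β) (top-◅◅ʳ α (arc ◅ β))) (top-◅◅ˡ α (arc ◅ β)) ⟩
      top ν           ≤⟨ flat ⟩
      suc (bot ν)     ≤⟨ s≤s bot≤hx ⟩
      suc (height x)  ∎

  Steep : ∀ {a b} → Walk a b → Set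
  Steep ν = 2 + bot ν ≤ top ν

  -- A steep cycle contains a peak x ↗ y ↗ z ↘ w; either x, y, z, w form a 3+1, or the arc x ↗ w
  -- shortens the cycle, which by induction becomes flat, and then no-flat-walk applies.
  no-steep-cycle : ∀ k {s} (ν : Walk s s) → length ν ≤ k → ¬ Steep ν
  no-steep-cycle zero    ε _ steep = 1+n≰n (≤-trans (n≤1+n _) steep)
  no-steep-cycle (suc k) ν ν≤1+k steep with rotate-to-bot ν
  ... | m , ν′ , length≡ , top≡ , hm≡ = shortcut (findPeak ν′ high (≤-trans (n≤1+n _) high))
    where
    high : 2 + height m ≤ top ν′
    high = subst₂ (λ b t → 2 + b ≤ t) (sym hm≡) (sym top≡) steep
    shortcut : Peak m m (length ν′) → ⊥
    shortcut peak with T? (lt x w)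
      where open Peak peak
    ... | no  x≮w = no-3+1-across-level x<y y<z (suc-injective (trans (sym hz≡1+hw) hz≡1+hy)) x≮w w≮z
      where open Peak peak
    ... | yes x<w = no-flat-walk x<y y<z hy≡1+hx (suffix ◅◅ prefix) hw≡hy w≮z
                      (proj₁ bounds) (subst (top (suffix ◅◅ prefix) ≤_) (sym hy≡1+hx) (proj₂ bounds))
      where
      open Peak peak
      hw≡hy = suc-injective (trans (sym hz≡1+hw) hz≡1+hy)
      hw≡1+hx = trans hw≡hy hy≡1+hx
      x↗w = up x∈X w∈X hw≡1+hx x<w
      shorter : length (prefix ◅◅ x↗w ◅ suffix) ≤ k
      shorter = ≤-trans (≤-reflexive (trans (length-◅◅ prefix _) (+-suc (length prefix) (length suffix))))
                        (≤-pred (≤-trans (n≤1+n _) (≤-trans short (≤-trans (≤-reflexive length≡) ν≤1+k))))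
      bounds = shortcut-bounds prefix x↗w suffix hw≡1+hx (≮⇒≥ (no-steep-cycle k _ shorter))

  cycle-flat : ∀ {s} (ν : Walk s s) → top ν ≤ suc (bot ν)
  cycle-flat ν = ≮⇒≥ (no-steep-cycle (length ν) ν ≤-refl)

  round-trip-flat : ∀ {p q} → Walk p q → Walk q p → height q ≤ suc (height p)
  round-trip-flat ω₁ ω₂ = ≤-trans (top-end ω₁) (≤-trans (top-◅◅ˡ ω₁ ω₂)
                            (≤-trans (cycle-flat (ω₁ ◅◅ ω₂)) (s≤s (≤-trans (bot-◅◅ˡ ω₁ ω₂) (bot-start ω₁)))))

  arc? : ∀ a b → Dec (Arc a b)
  arc? a b = map′ fromSum toSum
    (  ((T? (X a) ×-dec T? (X b)) ×-dec (height b ≟ℕ suc (height a) ×-dec T? (lt a b)))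
    ⊎-dec ((T? (X a) ×-dec T? (X b)) ×-dec (height a ≟ℕ suc (height b) ×-dec ¬? (T? (lt b a)))))
    where
    fromSum : _ → Arc a b
    fromSum (inj₁ ((a∈X , b∈X) , hb≡ , a<b)) = up a∈X b∈X hb≡ a<b
    fromSum (inj₂ ((a∈X , b∈X) , ha≡ , b≮a)) = down a∈X b∈X ha≡ b≮a
    toSum : Arc a b → _
    toSum (up a∈X b∈X hb≡ a<b)   = inj₁ ((a∈X , b∈X) , hb≡ , a<b)
    toSum (down a∈X b∈X ha≡ b≮a) = inj₂ ((a∈X , b∈X) , ha≡ , b≮a)

  open Closure arc? using (Closed; reach; reach-closed; reach-refl; reach-least; reach⇒Star; minimal-reach⇒Star)

  X-closed : Closed X
  X-closed (up a∈X _ _ _)   _ = a∈X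
  X-closed (down a∈X _ _ _) _ = a∈X

  -- listed as a single bicoloured part in front of the rest of X
  record Block : Set where
    field
      Q         : Sub size
      Q⊆X       : Q ⊆ X
      Q-closed  : Closed Q
      v         : Fin size
      v∈Q       : T (Q v)
      base      : ℕ
      base-pos  : 1 ≤ base
      Q-heights : ∀ q → T (Q q) → height q ≡ base ⊎ height q ≡ suc base

  find-block : ∀ x → T (X x) → Block
  find-block x x∈X with argmin (count ∘ reach) X x x∈X
  ... | v , v∈X , minimal with argmin height (reach v) v (reach-refl v)
  ...   | p , p∈Q , lowest = record
    { Q = reach v ; Q⊆X = Q⊆X ; Q-closed = reach-closed v ; v = v ; v∈Q = reach-refl v
    ; base = height p ; base-pos = height-pos p ; Q-heights = two-heights }
    where
    Q⊆X : reach v ⊆ X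
    Q⊆X = reach-least v X-closed v∈X
    -- by minimality of v, every element of its reach set is reached from v as well
    connected : ∀ {a b} → T (reach v a) → T (reach v b) → Walk a b
    connected {b = b} a∈Q b∈Q = reach⇒Star a∈Q ◅◅ minimal-reach⇒Star b∈Q (minimal b (Q⊆X b b∈Q))
    two-heights : ∀ q → T (reach v q) → height q ≡ height p ⊎ height q ≡ suc (height p)
    two-heights q q∈Q with m≤n⇒m<n∨m≡n (lowest q q∈Q)
    ... | inj₂ hp≡hq = inj₁ (sym hp≡hq)
    ... | inj₁ hp<hq = inj₂ (≤-antisym (round-trip-flat (connected p∈Q q∈Q) (connected q∈Q p∈Q)) hp<hq)

-- Listing a 3+1-free poset

module Construction (P : FinPoset) (free : Free3+1 P) where
  open FinPoset P hiding (trans)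
  open LongestChain P
  open ThreePlusOneFree P free

  record Realisation (X : Sub size) : Set where
    field
      L              : PartListing
      valid          : ValidListing L
      f              : Vertex L → Fin size
      f∈X            : ∀ u → T (X (f u))
      f-injective    : ∀ {u u′} → f u ≡ f u′ → u ≡ u′
      f-onto         : ∀ x → T (X x) → Σ[ u ∈ Vertex L ] f u ≡ x
      level≡height   : ∀ u → level L u ≡ height (f u)
      ListingLt⇒<    : ∀ u u′ → ListingLt L u u′ → f u <P f u′
      <⇒ListingLt    : ∀ u u′ → f u <P f u′ → ListingLt L u u′

  realise-empty : ∀ {X} → (∀ x → ¬ T (X x)) → Realisation X
  realise-empty X-empty = record
    { L = [] ; valid = [] ; f = λ () ; f∈X = λ () ; f-injective = λ { {() , _} }
    ; f-onto = λ x x∈X → ⊥-elim (X-empty x x∈X) ; level≡height = λ ()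
    ; ListingLt⇒< = λ () ; <⇒ListingLt = λ () }

  module Extension {X : Sub size} (block : Blocks.Block P free X) where
    open Blocks P free X using (up; down; Block)
    open Block block

    lower upper : Sub size
    lower x = Q x ∧ (height x ≡ᵇ base)
    upper x = Q x ∧ (height x ≡ᵇ suc base)

    graph : BicGraph
    graph = record
      { down = List.length (members lower)
      ; up   = List.length (members upper)
      ; edge = λ i j → lt (lookup (members lower) i) (lookup (members upper) j) }

    module _ (R : Realisation (X ─ Q)) where
      module R = Realisation R

      L : PartListing
      L = bic base graph ∷ R.L

      f : Vertex L → Fin size
      f (zero  , inj₁ i) = lookup (members lower) i
      f (zero  , inj₂ j) = lookup (members upper) j
      f (suc k , u)      = R.f (k , u)

      head∈Q : ∀ u → T (Q (f (zero , u)))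
      head∈Q (inj₁ i) = proj₁ (Equivalence.to T-∧ (lookup-members lower i))
      head∈Q (inj₂ j) = proj₁ (Equivalence.to T-∧ (lookup-members upper j))

      tail∉Q : ∀ k u → ¬ T (Q (f (suc k , u)))
      tail∉Q k u = proj₂ (∈─⁻ X Q (R.f∈X (k , u)))

      f∈X : ∀ u → T (X (f u))
      f∈X (zero  , u) = Q⊆X _ (head∈Q u)
      f∈X (suc k , u) = proj₁ (∈─⁻ X Q (R.f∈X (k , u)))

      height-lower : ∀ i → height (lookup (members lower) i) ≡ base
      height-lower i = ≡ᵇ⇒≡ _ _ (proj₂ (Equivalence.to T-∧ (lookup-members lower i)))

      height-upper : ∀ j → height (lookup (members upper) j) ≡ suc base
      height-upper j = ≡ᵇ⇒≡ _ _ (proj₂ (Equivalence.to T-∧ (lookup-members upper j)))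

      level≡height : ∀ u → level L u ≡ height (f u)
      level≡height (zero  , inj₁ i) = sym (height-lower i)
      level≡height (zero  , inj₂ j) = sym (height-upper j)
      level≡height (suc k , u)      = R.level≡height (k , u)

      head≢tail : ∀ u k u′ → f (zero , u) ≢ f (suc k , u′)
      head≢tail u k u′ eq = tail∉Q k u′ (subst (T ∘ Q) eq (head∈Q u))

      lower≢upper : ∀ i j → lookup (members lower) i ≢ lookup (members upper) j
      lower≢upper i j eq = 1+n≢n (trans (sym (height-upper j)) (trans (cong height (sym eq)) (height-lower i)))

      f-injective : ∀ {u u′} → f u ≡ f u′ → u ≡ u′
      f-injective {zero , inj₁ i} {zero , inj₁ i′} eq = cong (λ i → zero , inj₁ i) (lookup-members-injective lower eq)
      f-injective {zero , inj₂ j} {zero , inj₂ j′} eq = cong (λ j → zero , inj₂ j) (lookup-members-injective upper eq)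
      f-injective {zero , inj₁ i} {zero , inj₂ j}  eq = ⊥-elim (lower≢upper i j eq)
      f-injective {zero , inj₂ j} {zero , inj₁ i}  eq = ⊥-elim (lower≢upper i j (sym eq))
      f-injective {zero , u}      {suc k , u′}     eq = ⊥-elim (head≢tail u k u′ eq)
      f-injective {suc k , u}     {zero , u′}      eq = ⊥-elim (head≢tail u′ k u (sym eq))
      f-injective {suc k , u}     {suc k′ , u′}    eq with R.f-injective eq
      ... | refl = refl

      f-onto : ∀ x → T (X x) → Σ[ u ∈ Vertex L ] f u ≡ x
      f-onto x x∈X with T? (Q x)
      ... | no  x∉Q with R.f-onto x (∈─⁺ X Q x∈X x∉Q)
      ...   | (k , u) , eq = (suc k , u) , eq
      f-onto x x∈X | yes x∈Q with Q-heights x x∈Q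
      ... | inj₁ hx≡ with lookup-members-surjective lower x (Equivalence.from T-∧ (x∈Q , ≡⇒≡ᵇ _ _ hx≡))
      ...   | i , eq = (zero , inj₁ i) , eq
      f-onto x x∈X | yes x∈Q | inj₂ hx≡ with lookup-members-surjective upper x (Equivalence.from T-∧ (x∈Q , ≡⇒≡ᵇ _ _ hx≡))
      ...   | j , eq = (zero , inj₂ j) , eq

      -- Q is closed, so no arc leads from a later part into the block.
      head<tail : ∀ u k u′ → suc (height (f (zero , u))) ≡ height (f (suc k , u′)) → f (zero , u) <P f (suc k , u′)
      head<tail u k u′ h≡ with T? (lt (f (zero , u)) (f (suc k , u′)))
      ... | yes head<tail = head<tail
      ... | no  head≮tail =
        ⊥-elim (tail∉Q k u′ (Q-closed (down (f∈X (suc k , u′)) (f∈X (zero , u)) (sym h≡) head≮tail) (head∈Q u)))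

      tail≮head : ∀ u k u′ → suc (height (f (suc k , u′))) ≡ height (f (zero , u)) → ¬ f (suc k , u′) <P f (zero , u)
      tail≮head u k u′ h≡ tail<head =
        tail∉Q k u′ (Q-closed (up (f∈X (suc k , u′)) (f∈X (zero , u)) (sym h≡) tail<head) (head∈Q u))

      suc-level≡ : ∀ {u u′} → suc (level L u) ≡ level L u′ → suc (height (f u)) ≡ height (f u′)
      suc-level≡ {u} {u′} = subst₂ (λ l l′ → suc l ≡ l′) (level≡height u) (level≡height u′)

      ListingLt⇒< : ∀ u u′ → ListingLt L u u′ → f u <P f u′
      ListingLt⇒< u u′ (twoBelow gap) =
        height-gap⇒< (subst₂ (λ l l′ → 2 + l ≤ l′) (level≡height u) (level≡height u′) gap)
      ListingLt⇒< (zero , u) (suc k , u′) (before h≡ _) = head<tail u k u′ (suc-level≡ {zero , u} {suc k , u′} h≡)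
      ListingLt⇒< (suc k , u) (suc k′ , u′) (before h≡ (s≤s k<k′)) = R.ListingLt⇒< (k , u) (k′ , u′) (before h≡ k<k′)
      ListingLt⇒< (zero , inj₁ i) (zero , inj₂ j) (joined _ i<j) = i<j
      ListingLt⇒< (suc k , u) (suc k , u′) (joined h≡ edge) = R.ListingLt⇒< (k , u) (k , u′) (joined h≡ edge)

      lift : ∀ {k u k′ u′} → ListingLt R.L (k , u) (k′ , u′) → ListingLt L (suc k , u) (suc k′ , u′)
      lift (twoBelow gap)  = twoBelow gap
      lift (before h≡ k<k′) = before h≡ (s≤s k<k′)
      lift (joined h≡ edge) = joined h≡ edge

      adjacent⇒ListingLt : ∀ u u′ → f u <P f u′ → height (f u′) ≡ suc (height (f u)) → ListingLt L u u′
      adjacent⇒ListingLt (zero , inj₁ i) (zero , inj₂ j) i<j _ = joined refl i<j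
      adjacent⇒ListingLt (zero , inj₁ i) (zero , inj₁ i′) _ h≡ =
        ⊥-elim (1+n≢n (trans (cong suc (sym (height-lower i))) (trans (sym h≡) (height-lower i′))))
      adjacent⇒ListingLt (zero , inj₂ j) (zero , inj₂ j′) _ h≡ =
        ⊥-elim (1+n≢n (trans (cong suc (sym (height-upper j))) (trans (sym h≡) (height-upper j′))))
      adjacent⇒ListingLt (zero , inj₂ j) (zero , inj₁ i) j<i _ =
        ⊥-elim (<-asym (n<1+n base) (subst₂ _<_ (height-upper j) (height-lower i) (<⇒height< j<i)))
      adjacent⇒ListingLt (zero , u) (suc k , u′) _ h≡ =
        before (subst₂ (λ l l′ → suc l ≡ l′) (sym (level≡height (zero , u))) (sym (level≡height (suc k , u′))) (sym h≡))
               (s≤s z≤n)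
      adjacent⇒ListingLt (suc k , u) (zero , u′) tail<head h≡ = ⊥-elim (tail≮head u′ k u (sym h≡) tail<head)
      adjacent⇒ListingLt (suc k , u) (suc k′ , u′) lt _ = lift (R.<⇒ListingLt (k , u) (k′ , u′) lt)

      <⇒ListingLt : ∀ u u′ → f u <P f u′ → ListingLt L u u′
      <⇒ListingLt u u′ fu<fu′ with 2 + height (f u) ≤? height (f u′)
      ... | yes gap =
        twoBelow (subst₂ (λ l l′ → 2 + l ≤ l′) (sym (level≡height u)) (sym (level≡height u′)) gap)
      ... | no ¬gap = adjacent⇒ListingLt u u′ fu<fu′ (≤-antisym (≤-pred (≰⇒> ¬gap)) (<⇒height< fu<fu′))

      extend : Realisation X
      extend = record
        { L = L ; valid = base-pos ∷ R.valid ; f = f ; f∈X = f∈X ; f-injective = f-injective ; f-onto = f-onto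
        ; level≡height = level≡height ; ListingLt⇒< = ListingLt⇒< ; <⇒ListingLt = <⇒ListingLt }

  realise : ∀ k X → count X ≤ k → Realisation X
  realise k X count≤k with any? (λ x → T? (X x))
  ... | no ∄x = realise-empty (λ x x∈X → ∄x (x , x∈X))
  realise zero    X count≤0 | yes (x , x∈X) = contradiction (≤-trans (count-pos X x x∈X) count≤0) 1+n≰n
  realise (suc k) X count≤k | yes (x , x∈X) =
    Extension.extend block (realise k (X ─ Q) (≤-pred (≤-trans smaller count≤k)))
    where
    block = Blocks.find-block P free X x x∈X
    open Blocks.Block block
    smaller : count (X ─ Q) < count X
    smaller = count-< (λ y y∈ → proj₁ (∈─⁻ X Q y∈)) v (Q⊆X v v∈Q) (λ v∈ → proj₂ (∈─⁻ X Q v∈) v∈Q)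

mainTheorem2 : (P : FinPoset) → Free3+1 P →
    Σ PartListing λ L → ValidListing L × AssociatedPosetIs L P
mainTheorem2 P free = L , valid , bijection , λ u u′ → mk⇔ (ListingLt⇒< u u′) (<⇒ListingLt u u′)
  where
  open Construction P free
  open Realisation (realise (FinPoset.size P) (λ _ → true) (count≤n _))
  bijection : Vertex L ⤖ Fin (FinPoset.size P)
  bijection = record
    { to = f ; cong = cong f
    ; bijective = f-injective , λ x → proj₁ (f-onto x tt) , λ { refl → proj₂ (f-onto x tt) } }
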